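{- Let $w$ be a nonempty string and let $s_j$ denote the $j$-th shortest string of $\mathit{LFCand}(w)$. Then $|s_{j+1}| > 2|s_j|$ for every $1\le j < |\mathit{LFCand}(w)|$.
   Context: Strings are over a finite totally ordered alphabet $\Sigma$; $\Sigma^+$ is the set of nonempty strings. $\mathit{Suffix}(w)$ is the set of suffixes of $w$. For nonempty strings $x,y$, let $\mathit{lcp}(x,y)$ be the length of their longest common prefix; $x \prec y$ means either $x[\mathit{lcp}(x,y)+1] \prec y[\mathit{lcp}(x,y)+1]$ or $x$ is a proper prefix of $y$. For a set $S$ of nonempty strings, $\min_\prec S$ is its lexicographically smallest element. $\mathit{LFCand}(w) = \{x \in \mathit{Suffix}(w) \mid \exists y\in\Sigma^+ \text{ such that } xy = \min_\prec \mathit{Suffix}(wy)\}$. -}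

module Defs where

open import Data.Nat using (ℕ)
open import Data.Fin using (Fin) renaming (_<_ to _<ᶠ_)
open import Data.List using (List; []; _∷_; _++_; length)
open import Data.Product using (Σ; ∃; _×_; _,_)
open import Data.Sum using (_⊎_)
open import Relation.Binary.PropositionalEquality using (_≡_; _≢_)

-- Alphabet: the finite totally ordered set Fin k (any finite total order is
-- order-isomorphic to some Fin k).  Strings are lists over it.
Str : ℕ → Set
Str k = List (Fin k)

NonEmpty : ∀ {k} → Str k → Set
NonEmpty x = x ≢ []

IsSuffix : ∀ {k} → Str k → Str k → Set
IsSuffix x w = Σ _ λ u → u ++ x ≡ w

data _≺_ {k : ℕ} : Str k → Str k → Set where
  prefix : ∀ {b ys} → [] ≺ (b ∷ ys)
  here   : ∀ {a b xs ys} → a <ᶠ b → (a ∷ xs) ≺ (b ∷ ys)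
  there  : ∀ {a xs ys} → xs ≺ ys → (a ∷ xs) ≺ (a ∷ ys)

IsMinSuffix : ∀ {k} → Str k → Str k → Set
IsMinSuffix z v =
  (NonEmpty z × IsSuffix z v) ×
  (∀ s → NonEmpty s → IsSuffix s v → z ≡ s ⊎ z ≺ s)

LFCand : ∀ {k} → Str k → Str k → Set
LFCand w x =
  NonEmpty x × IsSuffix x w ×
  (Σ _ λ y → NonEmpty y × IsMinSuffix (x ++ y) (w ++ y))

-- Two candidates x and ux of w, witnessed by extensions y and y', give
-- xy ≺ uxy and uxy' ≺ xy'. Comparisons that flip with the extension force
-- x to be a prefix of ux. If |u| ≤ |x| this makes x = ut, and then
-- xy ≺ uxy cancels to ty ≺ xy, while minimality of xy among the suffixes of
-- wy gives xy ≺ ty. Hence |u| > |x|, i.e. |ux| > 2|x|.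
module Submission where

open import Defs
open import Data.Nat using (ℕ; _<_; _*_; _+_; _≤_; s≤s)
open import Data.Nat.Properties
  using (<-irrefl; <-asym; <⇒≢; <⇒≤; ≤-<-connex; +-identityʳ; +-monoˡ-<; ≤-trans; module ≤-Reasoning)
open import Data.List using ([]; _∷_; _++_; length)
open import Data.List.Properties
  using (length-++; length-++-≤ʳ; ++-assoc; ++-cancelʳ; ++-conicalʳ; ∷-injective; ∷-injectiveʳ)
open import Data.Product using (_×_; Σ; _,_)
open import Data.Sum using (inj₁; inj₂)
open import Data.Empty using (⊥-elim)
open import Function using (_∘_)
open import Relation.Nullary using (¬_)
open import Relation.Binary.PropositionalEquality using (_≡_; _≢_; refl; sym; trans; cong; subst₂)

private
  variable
    k : ℕ

≺-asym : {a b : Str k} → a ≺ b → ¬ b ≺ a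
≺-asym prefix    ()
≺-asym (here p)  (here q)  = <-asym p q
≺-asym (here p)  (there q) = <-irrefl refl p
≺-asym (there p) (here q)  = <-irrefl refl q
≺-asym (there p) (there q) = ≺-asym p q

≺-cancelˡ : (u : Str k) {a b : Str k} → (u ++ a) ≺ (u ++ b) → a ≺ b
≺-cancelˡ []      p         = p
≺-cancelˡ (c ∷ u) (here q)  = ⊥-elim (<-irrefl refl q)
≺-cancelˡ (c ∷ u) (there q) = ≺-cancelˡ u q

-- If extending a and b by y and by y' compares them in opposite directions,
-- the comparison is not decided inside a, so a is a prefix of b.
≺-flip⇒prefix : (a b y y' : Str k) → (a ++ y) ≺ (b ++ y) → (b ++ y') ≺ (a ++ y') →
                length a ≤ length b → Σ (Str k) λ v → b ≡ a ++ v
≺-flip⇒prefix []      b       y y' _         _         _ = b , refl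
≺-flip⇒prefix (c ∷ a) []      y y' _         _         ()
≺-flip⇒prefix (c ∷ a) (d ∷ b) y y' (here p)  (here q)  _ = ⊥-elim (<-asym p q)
≺-flip⇒prefix (c ∷ a) (d ∷ b) y y' (here p)  (there q) _ = ⊥-elim (<-irrefl refl p)
≺-flip⇒prefix (c ∷ a) (d ∷ b) y y' (there p) (here q)  _ = ⊥-elim (<-irrefl refl q)
≺-flip⇒prefix (c ∷ a) (d ∷ b) y y' (there p) (there q) (s≤s a≤b)
  with v , b≡av ← ≺-flip⇒prefix a b y y' p q a≤b = v , cong (c ∷_) b≡av

++-prefix-longer : (p q r s : Str k) → p ++ q ≡ r ++ s → length p ≤ length r →
                   Σ (Str k) λ t → r ≡ p ++ t
++-prefix-longer []      q r       s _  _ = r , refl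
++-prefix-longer (c ∷ p) q []      s _  ()
++-prefix-longer (c ∷ p) q (d ∷ r) s eq (s≤s p≤r) with refl , pq≡rs ← ∷-injective eq
  with t , r≡pt ← ++-prefix-longer p q r s pq≡rs p≤r = t , cong (c ∷_) r≡pt

++-suffix-longer : (u₁ u₂ x x' : Str k) → u₁ ++ x ≡ u₂ ++ x' → length x ≤ length x' →
                   Σ (Str k) λ u → x' ≡ u ++ x
++-suffix-longer u₁       []       x x' eq _ = u₁ , sym eq
++-suffix-longer []       (d ∷ u₂) x x' refl x≤x' =
  ⊥-elim (<-irrefl refl (≤-trans (s≤s (length-++-≤ʳ x' {u₂})) x≤x'))
++-suffix-longer (c ∷ u₁) (d ∷ u₂) x x' eq x≤x' =
  ++-suffix-longer u₁ u₂ x x' (∷-injectiveʳ eq) x≤x'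

length-<-++ˡ : {u : Str k} (s : Str k) → NonEmpty u → length s < length (u ++ s)
length-<-++ˡ {u = []}    s u≢[] = ⊥-elim (u≢[] refl)
length-<-++ˡ {u = c ∷ u} s _    = s≤s (length-++-≤ʳ s {u})

suffix-trans : {s t w : Str k} → IsSuffix s t → IsSuffix t w → IsSuffix s w
suffix-trans {s = s} (a , as≡t) (b , bt≡w) =
  b ++ a , trans (++-assoc b a s) (trans (cong (b ++_) as≡t) bt≡w)

suffix-++ʳ : {s w : Str k} (y : Str k) → IsSuffix s w → IsSuffix (s ++ y) (w ++ y)
suffix-++ʳ {s = s} y (v , vs≡w) = v , trans (sym (++-assoc v s y)) (cong (_++ y) vs≡w)

min-suffix-≺ : {x y w s : Str k} → IsMinSuffix (x ++ y) (w ++ y) → NonEmpty y →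
               IsSuffix s w → length x ≢ length s → (x ++ y) ≺ (s ++ y)
min-suffix-≺ {x = x} {y} {s = s} (_ , minimal) y≢[] s-suf |x|≢|s|
  with minimal (s ++ y) (y≢[] ∘ ++-conicalʳ s y) (suffix-++ʳ y s-suf)
... | inj₁ xy≡sy = ⊥-elim (|x|≢|s| (cong length (++-cancelʳ y x s xy≡sy)))
... | inj₂ xy≺sy = xy≺sy

min-suffix-period-long : {x y w u v : Str k} → IsMinSuffix (x ++ y) (w ++ y) → NonEmpty y →
                         IsSuffix (u ++ x) w → NonEmpty u → u ++ x ≡ x ++ v →
                         length x < length u
min-suffix-period-long {x = x} {y} {w} {u} {v} min y≢[] ux-suf u≢[] ux≡xv
  with ≤-<-connex (length u) (length x)
... | inj₂ |x|<|u| = |x|<|u|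
... | inj₁ |u|≤|x| with t , refl ← ++-prefix-longer u x x v ux≡xv |u|≤|x| =
  ⊥-elim (≺-asym xy≺ty ty≺xy)
  where
    t-suf : IsSuffix t w
    t-suf = suffix-trans (u , refl) (suffix-trans (u , refl) ux-suf)

    xy≺ty : ((u ++ t) ++ y) ≺ (t ++ y)
    xy≺ty = min-suffix-≺ min y≢[] t-suf (<⇒≢ (length-<-++ˡ t u≢[]) ∘ sym)

    ty≺xy : (t ++ y) ≺ ((u ++ t) ++ y)
    ty≺xy = ≺-cancelˡ u (subst₂ _≺_ (++-assoc u t y) (++-assoc u (u ++ t) y)
              (min-suffix-≺ min y≢[] ux-suf (<⇒≢ (length-<-++ˡ (u ++ t) u≢[]))))

-- The gap bound holds for any two candidates.
lemma6 : ∀ {k} (w : Str k) → NonEmpty w →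
    ∀ x x' → LFCand w x → LFCand w x' → length x < length x' →
    (∀ z → LFCand w z → ¬ (length x < length z × length z < length x')) →
    2 * length x < length x'
lemma6 w _ x x' (_ , (u₁ , u₁x≡w) , y , y≢[] , min) (_ , x'-suf@(u₂ , u₂x'≡w) , y' , y'≢[] , min')
       |x|<|x'| _
  with u , refl ← ++-suffix-longer u₁ u₂ x x' (trans u₁x≡w (sym u₂x'≡w)) (<⇒≤ |x|<|x'|) =
  begin-strict
    2 * length x                ≡⟨ cong (length x +_) (+-identityʳ (length x)) ⟩
    length x + length x         <⟨ +-monoˡ-< (length x) |x|<|u| ⟩
    length u + length x         ≡⟨ sym (length-++ u) ⟩
    length (u ++ x)             ∎
  where
    open ≤-Reasoning
    u≢[] : NonEmpty u
    u≢[] refl = <-irrefl refl |x|<|x'|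

    xy≺uxy : (x ++ y) ≺ ((u ++ x) ++ y)
    xy≺uxy = min-suffix-≺ min y≢[] x'-suf (<⇒≢ |x|<|x'|)

    uxy'≺xy' : ((u ++ x) ++ y') ≺ (x ++ y')
    uxy'≺xy' = min-suffix-≺ min' y'≢[] (suffix-trans (u , refl) x'-suf) (<⇒≢ |x|<|x'| ∘ sym)

    |x|<|u| : length x < length u
    |x|<|u| with v , ux≡xv ← ≺-flip⇒prefix x (u ++ x) y y' xy≺uxy uxy'≺xy' (<⇒≤ |x|<|x'|) =
      min-suffix-period-long min y≢[] x'-suf u≢[] ux≡xv
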